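{- Let $\ell$ be a prime dividing $N$, let $s\ge1$ be the $\ell$-adic valuation of $N$, and suppose $H$ has a $U_\ell$-operator. Let $g,h$ be relatively prime positive divisors of $N$ not divisible by $\ell$, let $\chi\in X_N$, $\psi=\theta\chi^{ -1}$, and let $t\le s$ be a positive integer such that $f_\chi$ divides $N/\ell^t$. If $t<s$, then $U_\ell\,\alpha^{\ell^tg,h}_{\chi,\psi}=\ell\,\alpha^{\ell^{t-1}g,h}_{\chi,\psi}$. If $t=s$ (and $\ell^sg\neq N$ in case $H$ is cuspidal at zero), then $(U_\ell-\chi^{ -1}(\ell))\,\alpha^{\ell^sg,h}_{\chi,\psi}=(\ell-1)\,\alpha^{\ell^{s-1}g,h}_{\chi,\psi}$.
   Context: Let $p$ be an odd prime, $M$ a positive integer with $p\nmid M\varphi(M)$, and $N=Mp$. Let $\Delta=(\mathbb{Z}/N\mathbb{Z})^\times/\langle-1\rangle$ with group elements $\langle a\rangle$. $H$ is either a space of level $N$ modular symbols: a $\mathbb{Z}_p[\Delta]$-module spanned by symbols $[u:v]$ ($u,v\in\mathbb{Z}/N\mathbb{Z}$ generating the unit ideal) satisfying $[u:v]=[-u:-v]=-[-v:u]$, $[u:v]=[u:u+v]+[u+v:v]$, $\langle a\rangle[u:v]=[au:av]$; or a space of cuspidal-at-zero symbols: the same with only symbols having $u,v\neq0$ and the second relation only for $u\neq-v$ (symbols with a zero entry interpreted as $0$). A $U_\ell$-operator on $H$ is a $\mathbb{Z}_p[\Delta]$-linear endomorphism $U_\ell$ with $U_\ell[\ell u:v]=\sum_{k=0}^{\ell-1}[u+kN/\ell:v]$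 for all $u,v\in\mathbb{Z}/N\mathbb{Z}$ with $(\ell u,v)=(1)$ (and $\ell u\neq0$ if $H$ is cuspidal at zero); it is extended $\mathcal{O}$-linearly. $\theta\colon\Delta\to\mathbb{C}_p^\times$ is a character, $\mathcal{O}=\mathbb{Z}_p[\mu_{\varphi(N)}]$, $X_N=\mathrm{Hom}((\mathbb{Z}/N\mathbb{Z})^\times,\mathcal{O}^\times)$; each $\chi\in X_N$ is viewed as a primitive Dirichlet character of conductor $f_\chi$. For relatively prime divisors $g,h$ of $N$, $\alpha^{g,h}_{\chi,\psi}=\frac{1}{\varphi(N)^2}\sum_{a,b\in(\mathbb{Z}/N\mathbb{Z})^\times}\chi^{ -1}(a)\psi^{ -1}(b)[ga:hb]\in H\otimes_{\mathbb{Z}_p}\mathcal{O}$. -}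

module Defs where

open import Level using (Level; _⊔_)
open import Data.Nat as ℕ using (ℕ; zero; suc; NonZero; ∣_-_∣)
open import Data.Nat.DivMod using (_mod_; _/_)
open import Data.Nat.Divisibility using (_∣_; _∣?_)
open import Data.Nat.Coprimality using (Coprime; coprime?)
open import Data.Nat.GCD using (gcd)
open import Data.Fin as Fin using (Fin; toℕ)
open import Data.List using (List; []; _∷_; filter; foldr; length; map; upTo)
open import Data.List.Base using (allFin)
open import Data.Product using (_×_; Σ; _,_)
open import Data.Sum using (_⊎_)
open import Data.Empty using (⊥)
open import Data.List.Membership.Propositional using (_∈_)
open import Relation.Nullary using (¬_; yes; no)
open import Relation.Binary.PropositionalEquality using (_≡_; _≢_)
open import Algebra.Bundles using (CommutativeRing)
open import Algebra.Module.Bundles using (Module)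

-- exact division of naturals (only used when the divisor divides);
-- n /ₑ 0 = 0 by convention
_/ₑ_ : ℕ → ℕ → ℕ
n /ₑ zero  = zero
n /ₑ suc k = n / suc k

totient : ℕ → ℕ
totient m = length (filter (λ k → coprime? k m) (upTo m))

module RingNotions {c ℓ : Level} (O : CommutativeRing c ℓ) where
  open CommutativeRing O

  fromℕ : ℕ → Carrier
  fromℕ zero    = 0#
  fromℕ (suc n) = 1# + fromℕ n

  IsIntegralDomain : Set (c ⊔ ℓ)
  IsIntegralDomain =
    (¬ (1# ≈ 0#)) × (∀ x y → x * y ≈ 0# → (x ≈ 0#) ⊎ (y ≈ 0#))

  -- abstract stand-in for O = Z_p[μ_φ(N)]: an integral domain of
  -- characteristic 0 in which every integer prime to p is a unit
  -- (i.e. O is a Z_(p)-algebra)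
  record IsZpCyclotomicLike (p : ℕ) : Set (c ⊔ ℓ) where
    field
      domain      : IsIntegralDomain
      charZero    : ∀ n → ¬ (fromℕ (suc n) ≈ 0#)
      primeToPInv : ∀ n → ¬ (p ∣ n) → Σ Carrier (λ y → y * fromℕ n ≈ 1#)

-- The setting: O a commutative ring, V an O-module (playing H ⊗ O),
-- N the level.

data Kind : Set where
  full cuspidalAtZero : Kind

module Setting {c ℓ m ℓm : Level} (O : CommutativeRing c ℓ)
               (V : Module O m ℓm) (N : ℕ) .{{_ : NonZero N}} where
  open CommutativeRing O
  open Module V
  open RingNotions O

  ZN : Set
  ZN = Fin N

  [_] : ℕ → ZN
  [ n ] = n mod N

  _⊕_ : ZN → ZN → ZN
  a ⊕ b = [ toℕ a ℕ.+ toℕ b ]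

  _⊗_ : ZN → ZN → ZN
  a ⊗ b = [ toℕ a ℕ.* toℕ b ]

  ⊖_ : ZN → ZN
  ⊖ a = [ N ℕ.∸ toℕ a ]

  IsUnit : ZN → Set
  IsUnit a = Coprime (toℕ a) N

  Unimodular : ZN → ZN → Set
  Unimodular u v = Coprime (gcd (toℕ u) (toℕ v)) N

  units : List ZN
  units = filter (λ a → coprime? (toℕ a) N) (allFin N)

  -- multiplicative inverse mod N (first b with a b ≡ 1; 0 if none)
  inv : ZN → ZN
  inv a with filter (λ b → (a ⊗ b) Fin.≟ [ 1 ]) (allFin N)
  ... | []    = [ 0 ]
  ... | b ∷ _ = b

  ΣV : {a : Level} {A : Set a} → List A → (A → Carrierᴹ) → Carrierᴹ
  ΣV xs f = foldr (λ x acc → f x +ᴹ acc) 0ᴹ xs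

  -- characters (Z/NZ)^× → O^× (values on non-units are irrelevant)
  record Character : Set (c ⊔ ℓ) where
    field
      χ     : ZN → Carrier
      one   : χ [ 1 ] ≈ 1#
      mult  : ∀ a b → IsUnit a → IsUnit b → χ (a ⊗ b) ≈ χ a * χ b
      unit  : ∀ a → IsUnit a → Σ Carrier (λ y → y * χ a ≈ 1#)

  inverseChar : (ZN → Carrier) → (ZN → Carrier)
  inverseChar χ a = χ (inv a)

  FactorsThrough : (ZN → Carrier) → ℕ → Set ℓ
  FactorsThrough χ f =
    ∀ a → IsUnit a → f ∣ ∣ toℕ a - 1 ∣ → χ a ≈ 1#

  record IsConductor (χ : ZN → Carrier) (f : ℕ) : Set (c ⊔ ℓ) where
    field
      divides : f ∣ N
      factors : FactorsThrough χ f
      least   : ∀ f′ → f′ ∣ N → FactorsThrough χ f′ → f ℕ.≤ f′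

  -- value at the integer n of the primitive character attached to χ,
  -- whose conductor is f: 0 if gcd(n,f) ≠ 1, otherwise χ(a) for a unit
  -- a mod N with a ≡ n mod f
  primitiveValue : (ZN → Carrier) → ℕ → ℕ → Carrier
  primitiveValue χ f n with coprime? n f
  ... | no _  = 0#
  ... | yes _ with filter (λ a → f ∣? ∣ toℕ a - n ∣) units
  ...   | []    = 0#
  ...   | a ∷ _ = χ a

  -- a space of modular symbols of level N (kind full) or cuspidal at zero,
  -- tensored with O: V is spanned by the symbols [u:v], carries the
  -- Δ-action, and the defining relations hold
  record SymbolSpace (kind : Kind) : Set (c ⊔ ℓ ⊔ m ⊔ ℓm) where
    field
      symb   : ZN → ZN → Carrierᴹ
      act   : ZN → Carrierᴹ → Carrierᴹ
      symb-zeroˡ : kind ≡ cuspidalAtZero → ∀ v → symb [ 0 ] v ≈ᴹ 0ᴹ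
      symb-zeroʳ : kind ≡ cuspidalAtZero → ∀ u → symb u [ 0 ] ≈ᴹ 0ᴹ
      rel-neg  : ∀ u v → Unimodular u v → symb u v ≈ᴹ symb (⊖ u) (⊖ v)
      rel-swap : ∀ u v → Unimodular u v → symb u v ≈ᴹ -ᴹ symb (⊖ v) u
      rel-sum  : ∀ u v → Unimodular u v →
                 (kind ≡ cuspidalAtZero → (u ⊕ v) ≢ [ 0 ]) →
                 symb u v ≈ᴹ symb u (u ⊕ v) +ᴹ symb (u ⊕ v) v
      act-symb  : ∀ a u v → IsUnit a → Unimodular u v →
                 act a (symb u v) ≈ᴹ symb (a ⊗ u) (a ⊗ v)
      act-cong : ∀ a x y → x ≈ᴹ y → act a x ≈ᴹ act a y
      act-+    : ∀ a x y → act a (x +ᴹ y) ≈ᴹ act a x +ᴹ act a y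
      act-*    : ∀ a r x → act a (r *ₗ x) ≈ᴹ r *ₗ act a x
      spanned  : ∀ x → Σ (List (Carrier × ZN × ZN)) (λ cs →
                   (∀ {r u v} → (r , u , v) ∈ cs → Unimodular u v) ×
                   (x ≈ᴹ ΣV cs (λ { (r , u , v) → r *ₗ symb u v })))

  module OnSymbols {kind : Kind} (S : SymbolSpace kind) where
    open SymbolSpace S

    record IsUOperator (l : ℕ) (U : Carrierᴹ → Carrierᴹ) : Set (c ⊔ ℓ ⊔ m ⊔ ℓm) where
      field
        U-cong : ∀ x y → x ≈ᴹ y → U x ≈ᴹ U y
        U-+    : ∀ x y → U (x +ᴹ y) ≈ᴹ U x +ᴹ U y
        U-*    : ∀ r x → U (r *ₗ x) ≈ᴹ r *ₗ U x
        U-Δ    : ∀ a x → IsUnit a → U (act a x) ≈ᴹ act a (U x)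
        U-symb  : ∀ u v → Unimodular ([ l ] ⊗ u) v →
                 (kind ≡ cuspidalAtZero → ([ l ] ⊗ u) ≢ [ 0 ]) →
                 U (symb ([ l ] ⊗ u) v) ≈ᴹ
                   ΣV (upTo l) (λ k → symb (u ⊕ [ k ℕ.* (N /ₑ l) ]) v)

    -- α^{g,h}_{χ,ψ} = (1/φ(N)²) Σ_{a,b} χ⁻¹(a) ψ⁻¹(b) [ga : hb],
    -- where e is the given inverse of φ(N)² in O and χ⁻¹, ψ⁻¹ are passed
    -- as functions
    α : (e : Carrier) → (g h : ℕ) → (χinv ψinv : ZN → Carrier) → Carrierᴹ
    α e g h χinv ψinv =
      e *ₗ ΣV units (λ a → ΣV units (λ b →
        (χinv a * ψinv b) *ₗ symb ([ g ] ⊗ a) ([ h ] ⊗ b)))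

-- Up to the scalar e = φ(N)⁻², α^{G,h} is T(G) = Σ_{a,b} χ⁻¹(a) ψ⁻¹(b) [G a : h b],
-- a, b running over (Z/NZ)^×.  Write N = lᵗ m (t ≥ 1).  Since a g is prime to l,
-- the l translates [lᵗ⁻¹ g a + k N/l : h b] produced by U_l, reindexed by
-- k = a g j mod l, are the symbols [lᵗ⁻¹ g a (1 + j m) : h b]; hence
-- U_l T(lᵗ g) = Σ_{j mod l} T_j, where T_j is T(lᵗ⁻¹ g) with a twisted by
-- 1 + j m.  Since f_χ ∣ m, a twist by a unit 1 + j m is absorbed by the
-- substitution a ↦ a (1 + j m)⁻¹, so T_j = T(lᵗ⁻¹ g).  If t < s then l ∣ m
-- and all l twists are units.  If t = s exactly one j₀ has l ∣ 1 + j₀ m;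
-- substituting a ↦ a (l + m), with l + m a unit congruent to l modulo f_χ,
-- turns T_{j₀} into χ⁻¹(l) T(lᵗ g).

module Submission where

open import Defs
open import Level using (Level)
open import Data.Nat as ℕ using (ℕ; zero; suc; NonZero; ∣_-_∣; _%_; _≤_; _<_; _^_; _∸_)
import Data.Nat.Properties as NatProps
open import Data.Nat.DivMod using (%-remove-+ʳ)
open import Data.Nat.Divisibility
  using (_∣_; _∣?_; divides; ∣-refl; ∣-trans; ∣-antisym; ∣1⇒≡1; ∣n⇒∣m*n; ∣m+n∣m⇒∣n; ∣n∣m%n⇒∣m;
         %-presˡ-∣; *-cancelˡ-∣; *-monoʳ-∣)
open import Data.Nat.Coprimality as Coprime using (Coprime; coprime?)
open import Data.Nat.Primality using (Prime; prime⇒nonZero)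
open import Data.Fin as Fin using (Fin; toℕ)
open import Data.Fin.Properties using (punchInᵢ≢i)
open import Data.Fin.Permutation using (Permutation; permutation)
open import Data.Vec.Functional using (removeAt)
open import Data.List using (List; []; _∷_; filter; allFin; upTo; applyUpTo; tabulate)
open import Data.List.Membership.Propositional using (_∈_)
open import Data.List.Membership.Propositional.Properties using (∈-filter⁺; ∈-filter⁻; ∈-allFin)
open import Data.List.Relation.Unary.Any using (here; there)
open import Data.Product using (Σ; _×_; _,_; proj₁; proj₂)
open import Data.Empty using (⊥-elim)
open import Relation.Nullary using (¬_; Dec; yes; no)
open import Relation.Unary using (Pred; Decidable)
open import Relation.Binary.PropositionalEquality as ≡ using (_≡_; _≢_; refl; cong; subst)
open import Algebra.Bundles using (CommutativeRing; CommutativeMonoid)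
open import Algebra.Module.Bundles using (Module)
import Algebra.Properties.CommutativeMonoid.Sum as MonoidSum
import Algebra.Properties.CommutativeSemigroup as CommutativeSemigroupProperties
import Relation.Binary.Reasoning.Setoid as SetoidReasoning

module Arithmetic where
  open import Data.Nat using (_+_; _*_)
  open import Data.Nat.Properties
  open import Data.Nat.DivMod
  open import Data.Nat.Divisibility
  open import Data.Nat.Coprimality using (coprime-divisor; coprime-Bézout)
  open import Data.Nat.GCD using (module Bézout; gcd; gcd[m,n]∣m; gcd[m,n]∣n)
  open import Data.Nat.Primality using (prime⇒irreducible; prime⇒nonTrivial; euclidsLemma)
  open import Data.Nat.Tactic.RingSolver using (solve-∀)
  open import Data.Fin.Properties using (toℕ-injective; toℕ-fromℕ<; toℕ<n)
  open import Data.Sum using (inj₁; inj₂)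
  open import Relation.Binary.PropositionalEquality hiding ([_])
  open ≡-Reasoning

  coprime-∣ʳ : ∀ {x n d} → Coprime x n → d ∣ n → Coprime x d
  coprime-∣ʳ c d∣n (e∣x , e∣d) = c (e∣x , ∣-trans e∣d d∣n)

  coprime-*ˡ : ∀ {x y n} → Coprime x n → Coprime y n → Coprime (x * y) n
  coprime-*ˡ cx cy {d} (d∣xy , d∣n) =
    cy (coprime-divisor (λ (e∣d , e∣x) → cx (e∣x , ∣-trans e∣d d∣n)) d∣xy , d∣n)

  coprime-*ʳ : ∀ {x a b} → Coprime x a → Coprime x b → Coprime x (a * b)
  coprime-*ʳ ca cb = Coprime.sym (coprime-*ˡ (Coprime.sym ca) (Coprime.sym cb))

  coprime-^ʳ : ∀ {x l} t → Coprime x l → Coprime x (l ^ t)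
  coprime-^ʳ zero    c (_ , e∣1) = ∣1⇒≡1 e∣1
  coprime-^ʳ (suc t) c = coprime-*ʳ c (coprime-^ʳ t c)

  prime∤⇒coprime : ∀ {l x} → Prime l → ¬ (l ∣ x) → Coprime x l
  prime∤⇒coprime pl l∤x {d} (d∣x , d∣l) with prime⇒irreducible pl d∣l
  ... | inj₁ d≡1 = d≡1
  ... | inj₂ refl = ⊥-elim (l∤x d∣x)

  coprime-% : ∀ {x n} .{{_ : NonZero n}} → Coprime x n → Coprime (x % n) n
  coprime-% c (d∣x%n , d∣n) = c (∣n∣m%n⇒∣m d∣n d∣x%n , d∣n)

  coprime-1+* : ∀ j m → Coprime (1 + j * m) m
  coprime-1+* j m {d} (d∣ , d∣m) =
    ∣1⇒≡1 (∣m+n∣m⇒∣n (subst (d ∣_) (+-comm 1 (j * m)) d∣) (∣n⇒∣m*n j d∣m))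

  coprime⇒*∣ : ∀ {a b n} → Coprime a b → a ∣ n → b ∣ n → a * b ∣ n
  coprime⇒*∣ {a} {b} c a∣n (divides q refl) with coprime-divisor c (subst (a ∣_) (*-comm q b) a∣n)
  ... | divides r refl = divides r (*-assoc r a b)

  ∣-nonZero : ∀ {f n} .{{_ : NonZero n}} → f ∣ n → NonZero f
  ∣-nonZero {zero} {n} f∣n = ⊥-elim (ℕ.≢-nonZero⁻¹ n (0∣⇒≡0 f∣n))
  ∣-nonZero {suc f} _ = _

  prime≢1 : ∀ {l} → Prime l → l ≢ 1
  prime≢1 pl = ℕ.nonTrivial⇒≢1 {{prime⇒nonTrivial pl}}

  coprime⇒∤ : ∀ {l a N} → Prime l → l ∣ N → Coprime a N → ¬ (l ∣ a)
  coprime⇒∤ pl l∣N c l∣a = prime≢1 pl (c (l∣a , l∣N))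

  inverse-mod : ∀ {a n} .{{_ : NonZero n}} → Coprime a n → Σ ℕ (λ b → (a * b) % n ≡ 1 % n)
  inverse-mod {a} {n} c with coprime-Bézout c
  ... | Bézout.+- x y eq = x , (begin
    (a * x) % n       ≡⟨ cong (_% n) (trans (*-comm a x) (sym eq)) ⟩
    (1 + y * n) % n   ≡⟨ [m+kn]%n≡m%n 1 y n ⟩
    1 % n             ∎)
  ... | Bézout.-+ x y eq = x * (n ∸ 1) , (begin
    (a * (x * (n ∸ 1))) % n                  ≡⟨ sym ([m+kn]%n≡m%n _ 1 n) ⟩
    (a * (x * (n ∸ 1)) + 1 * n) % n          ≡⟨ cong (λ k → (a * (x * (n ∸ 1)) + 1 * k) % n) n≡1+n' ⟩
    (a * (x * n') + 1 * (1 + n')) % n        ≡⟨ cong (_% n) (shuffle a x n') ⟩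
    (1 + (1 + x * a) * n') % n               ≡⟨ cong (λ k → (1 + k * n') % n) eq ⟩
    (1 + (y * n) * n') % n                   ≡⟨ cong (_% n) (reassoc y n n') ⟩
    (1 + (y * n') * n) % n                   ≡⟨ [m+kn]%n≡m%n 1 (y * n') n ⟩
    1 % n                                    ∎)
    where
    n' : ℕ
    n' = n ∸ 1
    n≡1+n' : n ≡ 1 + n'
    n≡1+n' = sym (m+[n∸m]≡n (ℕ.>-nonZero⁻¹ n))
    shuffle : ∀ a x n' → a * (x * n') + 1 * (1 + n') ≡ 1 + (1 + x * a) * n'
    shuffle = solve-∀
    reassoc : ∀ y n n' → 1 + (y * n) * n' ≡ 1 + (y * n') * n
    reassoc = solve-∀

  -- Congruence modulo f, in the two forms used by Defs: equal remainders,
  -- and f dividing the distance ∣ x - y ∣.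

  %≡⇒∣∣-∣ : ∀ {f} .{{_ : NonZero f}} x y → x % f ≡ y % f → f ∣ ∣ x - y ∣
  %≡⇒∣∣-∣ {f} x y eq = subst (f ∣_) (sym distance) (n∣m*n ∣ x / f - y / f ∣)
    where
    distance : ∣ x - y ∣ ≡ ∣ x / f - y / f ∣ * f
    distance = begin
      ∣ x - y ∣
        ≡⟨ cong₂ ∣_-_∣ (m≡m%n+[m/n]*n x f) (m≡m%n+[m/n]*n y f) ⟩
      ∣ x % f + x / f * f - y % f + y / f * f ∣
        ≡⟨ cong (λ r → ∣ x % f + x / f * f - r + y / f * f ∣) (sym eq) ⟩
      ∣ x % f + x / f * f - x % f + y / f * f ∣
        ≡⟨ ∣m+n-m+o∣≡∣n-o∣ (x % f) _ _ ⟩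
      ∣ x / f * f - y / f * f ∣
        ≡⟨ sym (*-distribʳ-∣-∣ f (x / f) (y / f)) ⟩
      ∣ x / f - y / f ∣ * f
        ∎

  private
    ∣∣-∣⇒%≡-ordered : ∀ {f} .{{_ : NonZero f}} {x y} → x ≤ y → f ∣ ∣ x - y ∣ → x % f ≡ y % f
    ∣∣-∣⇒%≡-ordered {f} {x} {y} x≤y d = begin
      x % f              ≡⟨ sym (%-remove-+ʳ x (subst (f ∣_) (m≤n⇒∣m-n∣≡n∸m x≤y) d)) ⟩
      (x + (y ∸ x)) % f  ≡⟨ cong (_% f) (m+[n∸m]≡n x≤y) ⟩
      y % f              ∎

  ∣∣-∣⇒%≡ : ∀ {f} .{{_ : NonZero f}} x y → f ∣ ∣ x - y ∣ → x % f ≡ y % f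
  ∣∣-∣⇒%≡ {f} x y d with ≤-total x y
  ... | inj₁ x≤y = ∣∣-∣⇒%≡-ordered x≤y d
  ... | inj₂ y≤x = sym (∣∣-∣⇒%≡-ordered y≤x (subst (f ∣_) (∣-∣-comm x y) d))

  %-absorb : ∀ {n} .{{_ : NonZero n}} a x c → (a + (x % n) * c) % n ≡ (a + x * c) % n
  %-absorb {n} a x c = begin
    (a + (x % n) * c) % n                    ≡⟨ %-distribˡ-+ a _ n ⟩
    (a % n + ((x % n) * c) % n) % n          ≡⟨ cong (λ k → (a % n + k) % n) product ⟩
    (a % n + (x * c) % n) % n                ≡⟨ sym (%-distribˡ-+ a _ n) ⟩
    (a + x * c) % n                          ∎
    where
    product : ((x % n) * c) % n ≡ (x * c) % n
    product = begin
      ((x % n) * c) % n                ≡⟨ %-distribˡ-* (x % n) c n ⟩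
      ((x % n % n) * (c % n)) % n      ≡⟨ cong (λ k → (k * (c % n)) % n) (m%n%n≡m%n x n) ⟩
      ((x % n) * (c % n)) % n          ≡⟨ sym (%-distribˡ-* x c n) ⟩
      (x * c) % n                      ∎

  *-/ₑ : ∀ {n} d .{{_ : NonZero d}} → d ∣ n → n ≡ d * (n /ₑ d)
  *-/ₑ (suc k) d∣n = sym (m*[n/m]≡n d∣n)

  ^-∣ : ∀ l {t s} → t ≤ s → l ^ t ∣ l ^ s
  ^-∣ l {t} {s} t≤s = divides (l ^ (s ∸ t)) (begin
    l ^ s                ≡⟨ cong (l ^_) (sym (m+[n∸m]≡n t≤s)) ⟩
    l ^ (t + (s ∸ t))    ≡⟨ ^-distribˡ-+-* l t (s ∸ t) ⟩
    l ^ t * l ^ (s ∸ t)  ≡⟨ *-comm (l ^ t) _ ⟩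
    l ^ (s ∸ t) * l ^ t  ∎)

  -- For a prime l not dividing m, at most one residue j mod l makes
  -- 1 + j m divisible by l: the difference of two such is ∣ j - j′ ∣ m.
  ∣1+*-unique : ∀ {l m} → Prime l → ¬ (l ∣ m) → ∀ (j j′ : Fin l) →
                l ∣ 1 + toℕ j * m → l ∣ 1 + toℕ j′ * m → j ≡ j′
  ∣1+*-unique {l} {m} pl l∤m j j′ l∣W l∣W′ =
    toℕ-injective (∣m-n∣≡0⇒m≡n (trans (sym (m<n⇒m%n≡m close)) (n∣m⇒m%n≡0 _ l l∣dist)))
    where
    instance
      _ : NonZero l
      _ = prime⇒nonZero pl
    l∣dist·m : l ∣ ∣ toℕ j - toℕ j′ ∣ * m
    l∣dist·m = subst (l ∣_)
      (trans (∣m+n-m+o∣≡∣n-o∣ 1 (toℕ j * m) (toℕ j′ * m)) (sym (*-distribʳ-∣-∣ m (toℕ j) (toℕ j′))))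
      (%≡⇒∣∣-∣ (1 + toℕ j * m) (1 + toℕ j′ * m) (trans (n∣m⇒m%n≡0 _ l l∣W) (sym (n∣m⇒m%n≡0 _ l l∣W′))))
    l∣dist : l ∣ ∣ toℕ j - toℕ j′ ∣
    l∣dist with euclidsLemma _ m pl l∣dist·m
    ... | inj₁ l∣d = l∣d
    ... | inj₂ l∣m = ⊥-elim (l∤m l∣m)
    close : ∣ toℕ j - toℕ j′ ∣ < l
    close = ≤-<-trans (∣m-n∣≤m⊔n (toℕ j) (toℕ j′)) (⊔-lub (toℕ<n j) (toℕ<n j′))

  -- Such a residue exists: j₀ ≡ -m⁻¹ (mod l).
  ∣1+*-exists : ∀ {l m} → Prime l → ¬ (l ∣ m) → Σ (Fin l) λ j₀ → l ∣ 1 + toℕ j₀ * m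
  ∣1+*-exists {l} {m} pl l∤m with inverse-mod {m} {l} ⦃ prime⇒nonZero pl ⦄ (prime∤⇒coprime pl l∤m)
  ... | b , mb≡1 = j₀ , m%n≡0⇒n∣m _ l (begin
    (1 + toℕ j₀ * m) % l               ≡⟨ cong (λ k → (1 + k * m) % l) (toℕ-fromℕ< (m%n<n _ l)) ⟩
    (1 + ((l ∸ 1) * b) % l * m) % l    ≡⟨ %-absorb {l} 1 _ m ⟩
    (1 + (l ∸ 1) * b * m) % l          ≡⟨ cong (λ k → (1 + k) % l) (reorder (l ∸ 1) b m) ⟩
    (1 + (m * b) * (l ∸ 1)) % l        ≡⟨ sym (%-absorb {l} 1 (m * b) (l ∸ 1)) ⟩
    (1 + (m * b) % l * (l ∸ 1)) % l    ≡⟨ cong (λ k → (1 + k * (l ∸ 1)) % l) mb≡1 ⟩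
    (1 + 1 % l * (l ∸ 1)) % l          ≡⟨ %-absorb {l} 1 1 (l ∸ 1) ⟩
    (1 + 1 * (l ∸ 1)) % l              ≡⟨ cong (λ k → (1 + k) % l) (*-identityˡ (l ∸ 1)) ⟩
    (1 + (l ∸ 1)) % l                  ≡⟨ cong (_% l) (m+[n∸m]≡n (ℕ.>-nonZero⁻¹ l)) ⟩
    l % l                              ≡⟨ n%n≡0 l ⟩
    0                                  ∎)
    where
    instance
      _ : NonZero l
      _ = prime⇒nonZero pl
    j₀ : Fin l
    j₀ = ((l ∸ 1) * b) mod l
    reorder : ∀ a b m → a * b * m ≡ m * b * a
    reorder = solve-∀

  -- Hence one residue j₀ is distinguished and 1 + j m is prime to l for
  -- every other j; j₀ gives the one degenerate term of U_l when t = s.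
  distinguished-residue : ∀ {l m} → Prime l → ¬ (l ∣ m) →
    Σ (Fin l) λ j₀ → l ∣ 1 + toℕ j₀ * m × (∀ j → j ≢ j₀ → Coprime (1 + toℕ j * m) l)
  distinguished-residue pl l∤m with ∣1+*-exists pl l∤m
  ... | j₀ , l∣W₀ = j₀ , l∣W₀ ,
        λ j j≢j₀ → prime∤⇒coprime pl (λ l∣W → j≢j₀ (∣1+*-unique pl l∤m j j₀ l∣W l∣W₀))

  -- The ring Z/nZ as represented in Defs: Fin n with reduced operations.
  -- a ≋ x says that the residue a represents the natural number x; every
  -- identity between residues is proved by computing with representatives.
  module Residues (n : ℕ) .{{_ : NonZero n}} where

    [_] : ℕ → Fin n
    [ x ] = x mod n

    _⊕_ : Fin n → Fin n → Fin n
    a ⊕ b = [ toℕ a + toℕ b ]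

    _⊗_ : Fin n → Fin n → Fin n
    a ⊗ b = [ toℕ a * toℕ b ]

    infix 4 _≋_
    _≋_ : Fin n → ℕ → Set
    a ≋ x = toℕ a ≡ x % n

    ≋-[] : ∀ x → [ x ] ≋ x
    ≋-[] x = toℕ-fromℕ< (m%n<n x n)

    ≋-toℕ : ∀ a → a ≋ toℕ a
    ≋-toℕ a = sym (m<n⇒m%n≡m (toℕ<n a))

    ≋-⊗ : ∀ {a b x y} → a ≋ x → b ≋ y → a ⊗ b ≋ x * y
    ≋-⊗ {a} {b} {x} {y} a≋x b≋y = begin
      toℕ [ toℕ a * toℕ b ]    ≡⟨ ≋-[] _ ⟩
      (toℕ a * toℕ b) % n      ≡⟨ cong₂ (λ u v → (u * v) % n) a≋x b≋y ⟩
      ((x % n) * (y % n)) % n  ≡⟨ sym (%-distribˡ-* x y n) ⟩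
      (x * y) % n              ∎

    ≋-⊕ : ∀ {a b x y} → a ≋ x → b ≋ y → a ⊕ b ≋ x + y
    ≋-⊕ {a} {b} {x} {y} a≋x b≋y = begin
      toℕ [ toℕ a + toℕ b ]    ≡⟨ ≋-[] _ ⟩
      (toℕ a + toℕ b) % n      ≡⟨ cong₂ (λ u v → (u + v) % n) a≋x b≋y ⟩
      ((x % n) + (y % n)) % n  ≡⟨ sym (%-distribˡ-+ x y n) ⟩
      (x + y) % n              ∎

    ≋-unique : ∀ {a b x y} → a ≋ x → b ≋ y → x % n ≡ y % n → a ≡ b
    ≋-unique a≋x b≋y x≡y = toℕ-injective (trans a≋x (trans x≡y (sym b≋y)))

    ⊗-comm : ∀ a b → a ⊗ b ≡ b ⊗ a
    ⊗-comm a b = cong [_] (*-comm (toℕ a) (toℕ b))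

    ⊗-assoc : ∀ a b c → (a ⊗ b) ⊗ c ≡ a ⊗ (b ⊗ c)
    ⊗-assoc a b c = ≋-unique (≋-⊗ (≋-⊗ (≋-toℕ a) (≋-toℕ b)) (≋-toℕ c))
                             (≋-⊗ (≋-toℕ a) (≋-⊗ (≋-toℕ b) (≋-toℕ c)))
                             (cong (_% n) (*-assoc (toℕ a) (toℕ b) (toℕ c)))

    ⊗-identityʳ : ∀ a → a ⊗ [ 1 ] ≡ a
    ⊗-identityʳ a = ≋-unique (≋-⊗ (≋-toℕ a) (≋-[] 1)) (≋-toℕ a) (cong (_% n) (*-identityʳ (toℕ a)))

    ⊗-identityˡ : ∀ a → [ 1 ] ⊗ a ≡ a
    ⊗-identityˡ a = trans (⊗-comm [ 1 ] a) (⊗-identityʳ a)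

    ⊗-cancel : ∀ a {b c} → b ⊗ c ≡ [ 1 ] → (a ⊗ b) ⊗ c ≡ a
    ⊗-cancel a {b} {c} bc≡1 = trans (⊗-assoc a b c) (trans (cong (a ⊗_) bc≡1) (⊗-identityʳ a))

    ⊗-cancelˡ : ∀ {b c} a → b ⊗ c ≡ [ 1 ] → b ⊗ (c ⊗ a) ≡ a
    ⊗-cancelˡ {b} {c} a bc≡1 = trans (sym (⊗-assoc b c a)) (trans (cong (_⊗ a) bc≡1) (⊗-identityˡ a))

    IsUnit : Fin n → Set
    IsUnit a = Coprime (toℕ a) n

    unit-≋ : ∀ {a x} → a ≋ x → Coprime x n → IsUnit a
    unit-≋ a≋x c = subst (λ v → Coprime v n) (sym a≋x) (coprime-% c)

    unit-⊗ : ∀ {a b} → IsUnit a → IsUnit b → IsUnit (a ⊗ b)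
    unit-⊗ {a} {b} ua ub = unit-≋ (≋-⊗ (≋-toℕ a) (≋-toℕ b)) (coprime-*ˡ ua ub)

    unit-inverse : ∀ a → IsUnit a → Σ (Fin n) (λ b → a ⊗ b ≡ [ 1 ])
    unit-inverse a ua with inverse-mod ua
    ... | b , ab≡1 = [ b ] , ≋-unique (≋-⊗ (≋-toℕ a) (≋-[] b)) (≋-[] 1) ab≡1

    ≋⇒%-divisor : ∀ {f} .{{_ : NonZero f}} {a x} → f ∣ n → a ≋ x → toℕ a % f ≡ x % f
    ≋⇒%-divisor {f} {a} {x} f∣n a≋x = trans (cong (_% f) a≋x) (m∣n⇒o%n%m≡o%m f n x f∣n)

    unit-[] : ∀ {x l m} t → n ≡ l ^ t * m → Coprime x l → Coprime x m → IsUnit [ x ]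
    unit-[] {x} {l} {m} t n≡ cl cm =
      unit-≋ (≋-[] x) (subst (Coprime x) (sym n≡) (coprime-*ʳ (coprime-^ʳ t cl) cm))

  module LevelArithmetic (N : ℕ) .{{_ : NonZero N}} where
    open Residues N

    split-factor : ∀ l L g a → [ (l * L) * g ] ⊗ a ≡ [ l ] ⊗ ([ L * g ] ⊗ a)
    split-factor l L g a = ≋-unique (≋-⊗ (≋-[] _) (≋-toℕ a)) (≋-⊗ (≋-[] l) (≋-⊗ (≋-[] _) (≋-toℕ a)))
      (cong (_% N) (reassoc l L g (toℕ a)))
      where
      reassoc : ∀ l L g a → (l * L * g) * a ≡ l * (L * g * a)
      reassoc = solve-∀

    shift-as-product : ∀ l .{{_ : NonZero l}} d L m g a j → N ≡ l * d → d ≡ L * m →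
      ([ L * g ] ⊗ a) ⊕ [ ((toℕ a * g * j) % l) * d ] ≡ [ L * g ] ⊗ (a ⊗ [ 1 + j * m ])
    shift-as-product l d L m g a j N≡ld d≡Lm =
      ≋-unique (≋-⊕ (≋-⊗ (≋-[] _) (≋-toℕ a)) (≋-[] _))
               (≋-⊗ (≋-[] _) (≋-⊗ (≋-toℕ a) (≋-[] _))) (sym congruent)
      where
      A k : ℕ
      A = toℕ a
      k = A * g * j
      expand : ∀ L g A j m → L * g * (A * (1 + j * m)) ≡ L * g * A + (A * g * j) * (L * m)
      expand = solve-∀
      regroup : ∀ x r q l d → x + (r + q * l) * d ≡ (x + r * d) + q * (l * d)
      regroup = solve-∀
      congruent : (L * g * (A * (1 + j * m))) % N ≡ (L * g * A + (k % l) * d) % N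
      congruent = begin
        (L * g * (A * (1 + j * m))) % N
          ≡⟨ cong (_% N) (expand L g A j m) ⟩
        (L * g * A + k * (L * m)) % N
          ≡⟨ cong (λ v → (L * g * A + k * v) % N) (sym d≡Lm) ⟩
        (L * g * A + k * d) % N
          ≡⟨ cong (λ v → (L * g * A + v * d) % N) (m≡m%n+[m/n]*n k l) ⟩
        (L * g * A + (k % l + (k / l) * l) * d) % N
          ≡⟨ cong (_% N) (regroup (L * g * A) (k % l) (k / l) l d) ⟩
        (L * g * A + (k % l) * d + (k / l) * (l * d)) % N
          ≡⟨ cong (λ v → (L * g * A + (k % l) * d + (k / l) * v) % N) (sym N≡ld) ⟩
        (L * g * A + (k % l) * d + (k / l) * N) % N
          ≡⟨ [m+kn]%n≡m%n _ (k / l) N ⟩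
        (L * g * A + (k % l) * d) % N
          ∎

    degenerate-product : ∀ l L m g a j₀ q → N ≡ (l * L) * m → 1 + j₀ * m ≡ l * q →
      [ L * g ] ⊗ ((a ⊗ [ l + m ]) ⊗ [ 1 + j₀ * m ]) ≡ [ (l * L) * g ] ⊗ a
    degenerate-product l L m g a j₀ q N≡lLm W₀≡lq =
      ≋-unique (≋-⊗ (≋-[] _) (≋-⊗ (≋-⊗ (≋-toℕ a) (≋-[] _)) (≋-[] _))) (≋-⊗ (≋-[] _) (≋-toℕ a)) congruent
      where
      A : ℕ
      A = toℕ a
      expand : ∀ L g A l m j₀ → L * g * (A * (l + m) * (1 + j₀ * m))
                             ≡ L * g * A * (l + l * j₀ * m) + L * g * A * m * (1 + j₀ * m)
      expand = solve-∀
      regroup : ∀ L g A l m j₀ q → L * g * A * (l + l * j₀ * m) + L * g * A * m * (l * q)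
                                ≡ (l * L) * g * A + (g * A * (j₀ + q)) * ((l * L) * m)
      regroup = solve-∀
      congruent : (L * g * (A * (l + m) * (1 + j₀ * m))) % N ≡ ((l * L) * g * A) % N
      congruent = begin
        (L * g * (A * (l + m) * (1 + j₀ * m))) % N
          ≡⟨ cong (_% N) (expand L g A l m j₀) ⟩
        (L * g * A * (l + l * j₀ * m) + L * g * A * m * (1 + j₀ * m)) % N
          ≡⟨ cong (λ v → (L * g * A * (l + l * j₀ * m) + L * g * A * m * v) % N) W₀≡lq ⟩
        (L * g * A * (l + l * j₀ * m) + L * g * A * m * (l * q)) % N
          ≡⟨ cong (_% N) (regroup L g A l m j₀ q) ⟩
        ((l * L) * g * A + (g * A * (j₀ + q)) * ((l * L) * m)) % N
          ≡⟨ cong (λ v → ((l * L) * g * A + (g * A * (j₀ + q)) * v) % N) (sym N≡lLm) ⟩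
        ((l * L) * g * A + (g * A * (j₀ + q)) * N) % N
          ≡⟨ [m+kn]%n≡m%n _ (g * A * (j₀ + q)) N ⟩
        ((l * L) * g * A) % N
          ∎

    unimodular-pair : ∀ G h a b → IsUnit a → IsUnit b → Coprime G h →
      Coprime (gcd (toℕ ([ G ] ⊗ a)) (toℕ ([ h ] ⊗ b))) N
    unimodular-pair G h a b ua ub G⊥h {d} (d∣gcd , d∣N) =
      G⊥h (divides-factor G a ua (∣-trans d∣gcd (gcd[m,n]∣m _ _)) ,
           divides-factor h b ub (∣-trans d∣gcd (gcd[m,n]∣n (toℕ ([ G ] ⊗ a)) _)))
      where
      divides-factor : ∀ x a → IsUnit a → d ∣ toℕ ([ x ] ⊗ a) → d ∣ x
      divides-factor x a ua d∣xa = coprime-divisor (Coprime.sym (coprime-∣ʳ ua d∣N))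
        (subst (d ∣_) (*-comm x (toℕ a)) (∣n∣m%n⇒∣m d∣N (subst (d ∣_) (≋-⊗ (≋-[] x) (≋-toℕ a)) d∣xa)))

    zero-product : ∀ G a → IsUnit a → [ G ] ⊗ a ≡ [ 0 ] → N ∣ G
    zero-product G a ua Ga≡0 =
      coprime-divisor (Coprime.sym ua) (subst (N ∣_) (*-comm G (toℕ a)) (m%n≡0⇒n∣m _ N Ga%N≡0))
      where
      Ga%N≡0 : (G * toℕ a) % N ≡ 0
      Ga%N≡0 = trans (sym (≋-⊗ (≋-[] G) (≋-toℕ a)))
                 (trans (cong toℕ Ga≡0) (trans (≋-[] 0) (m<n⇒m%n≡m (ℕ.>-nonZero⁻¹ N))))

open Arithmetic

-- Multiplication by a number prime to l permutes Z/lZ, so a sum over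
-- Fin l in any commutative monoid may be reindexed along k ↦ A k mod l.
sum-reindex-* : ∀ {c ℓ} (M : CommutativeMonoid c ℓ) → let open CommutativeMonoid M in
  ∀ l .{{_ : NonZero l}} A → Coprime A l → (F : ℕ → Carrier) →
  MonoidSum.sum M (λ (k : Fin l) → F (toℕ k)) ≈ MonoidSum.sum M (λ (j : Fin l) → F ((A ℕ.* toℕ j) % l))
sum-reindex-* M l A A⊥l F with inverse-mod A⊥l
... | B , AB≡1 = trans (sum-permute (λ k → F (toℕ k)) multiplyByA)
                       (sum-cong-≋ (λ j → reflexive (cong F (≋-⊗ (≋-[] A) (≋-toℕ j)))))
  where
  open CommutativeMonoid M
  open MonoidSum M using (sum-permute; sum-cong-≋)
  open Residues l
  AB≡[1] : [ A ] ⊗ [ B ] ≡ [ 1 ]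
  AB≡[1] = ≋-unique (≋-⊗ (≋-[] A) (≋-[] B)) (≋-[] 1) AB≡1
  BA≡[1] : [ B ] ⊗ [ A ] ≡ [ 1 ]
  BA≡[1] = ≡.trans (⊗-comm [ B ] [ A ]) AB≡[1]
  multiplyByA : Permutation l l
  multiplyByA = permutation ([ A ] ⊗_) ([ B ] ⊗_)
    (λ j → ⊗-cancelˡ {[ A ]} j AB≡[1]) (λ j → ⊗-cancelˡ {[ B ]} j BA≡[1])

module ModuleIdentities {c ℓ m ℓm : Level} (O : CommutativeRing c ℓ) (V : Module O m ℓm) where
  open Module V
  open SetoidReasoning ≈ᴹ-setoid

  *ₗ-cancel-term : ∀ e r x z → e *ₗ (r *ₗ x +ᴹ z) +ᴹ -ᴹ (r *ₗ (e *ₗ x)) ≈ᴹ e *ₗ z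
  *ₗ-cancel-term e r x z = begin
    e *ₗ (r *ₗ x +ᴹ z) +ᴹ -ᴹ y        ≈⟨ +ᴹ-congʳ (*ₗ-distribˡ e _ _) ⟩
    (e *ₗ (r *ₗ x) +ᴹ e *ₗ z) +ᴹ -ᴹ y  ≈⟨ +ᴹ-congʳ (+ᴹ-congʳ (*ₗ-comm e r x)) ⟩
    (y +ᴹ e *ₗ z) +ᴹ -ᴹ y             ≈⟨ +ᴹ-congʳ (+ᴹ-comm y _) ⟩
    (e *ₗ z +ᴹ y) +ᴹ -ᴹ y             ≈⟨ +ᴹ-assoc _ y (-ᴹ y) ⟩
    e *ₗ z +ᴹ (y +ᴹ -ᴹ y)             ≈⟨ +ᴹ-congˡ (-ᴹ‿inverseʳ y) ⟩
    e *ₗ z +ᴹ 0ᴹ                      ≈⟨ +ᴹ-identityʳ _ ⟩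
    e *ₗ z                            ∎
    where
    y = r *ₗ (e *ₗ x)

module Units {c ℓ m ℓm : Level} (O : CommutativeRing c ℓ) (V : Module O m ℓm)
             (N : ℕ) .{{_ : NonZero N}} where
  open Setting O V N
  -- [_], _⊕_, _⊗_ and IsUnit of Setting are by definition those of Residues N
  open Residues N hiding ([_]; _⊕_; _⊗_; IsUnit)

  ∈units⇒unit : ∀ {a} → a ∈ units → IsUnit a
  ∈units⇒unit a∈ = proj₂ (∈-filter⁻ (λ a → coprime? (toℕ a) N) {xs = allFin N} a∈)

  unit⇒∈units : ∀ {a} → IsUnit a → a ∈ units
  unit⇒∈units {a} ua = ∈-filter⁺ (λ a → coprime? (toℕ a) N) (∈-allFin a) ua

  inv-inverse : ∀ a → IsUnit a → a ⊗ inv a ≡ [ 1 ]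
  inv-inverse a ua with filter (λ b → (a ⊗ b) Fin.≟ [ 1 ]) (allFin N) in candidates
  ... | b ∷ _ = proj₂ (∈-filter⁻ (λ b → (a ⊗ b) Fin.≟ [ 1 ]) {xs = allFin N}
                        (subst (b ∈_) (≡.sym candidates) (here refl)))
  ... | [] with unit-inverse a ua
  ...   | b , ab≡1 =
    absurd (subst (b ∈_) candidates (∈-filter⁺ (λ b → (a ⊗ b) Fin.≟ [ 1 ]) (∈-allFin b) ab≡1))
    where
    absurd : {B : Set} → b ∈ [] → B
    absurd ()

  inv-unit : ∀ a → IsUnit a → IsUnit (inv a)
  inv-unit a ua {d} (d∣inv , d∣N) = ∣1⇒≡1 (∣n∣m%n⇒∣m d∣N d∣1%N)
    where
    d∣1%N : d ∣ 1 % N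
    d∣1%N = subst (d ∣_) (≡.trans (cong toℕ (inv-inverse a ua)) (≋-[] 1))
                  (subst (d ∣_) (≡.sym (≋-[] _)) (%-presˡ-∣ (∣n⇒∣m*n (toℕ a) d∣inv) d∣N))

  inv-unique : ∀ a b → IsUnit a → a ⊗ b ≡ [ 1 ] → b ≡ inv a
  inv-unique a b ua ab≡1 = begin
    b                    ≡⟨ ≡.sym (⊗-cancel b (inv-inverse a ua)) ⟩
    (b ⊗ a) ⊗ inv a      ≡⟨ cong (_⊗ inv a) (⊗-comm b a) ⟩
    (a ⊗ b) ⊗ inv a      ≡⟨ cong (_⊗ inv a) ab≡1 ⟩
    [ 1 ] ⊗ inv a        ≡⟨ ⊗-identityˡ (inv a) ⟩
    inv a                ∎
    where open ≡.≡-Reasoning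

  inv-⊗ : ∀ a b → IsUnit a → IsUnit b → inv (a ⊗ b) ≡ inv a ⊗ inv b
  inv-⊗ a b ua ub = ≡.sym (inv-unique (a ⊗ b) (inv a ⊗ inv b) (unit-⊗ ua ub) product≡1)
    where
    open ≡.≡-Reasoning
    product≡1 : (a ⊗ b) ⊗ (inv a ⊗ inv b) ≡ [ 1 ]
    product≡1 = begin
      (a ⊗ b) ⊗ (inv a ⊗ inv b)     ≡⟨ cong (_⊗ (inv a ⊗ inv b)) (⊗-comm a b) ⟩
      (b ⊗ a) ⊗ (inv a ⊗ inv b)     ≡⟨ ≡.sym (⊗-assoc (b ⊗ a) (inv a) (inv b)) ⟩
      ((b ⊗ a) ⊗ inv a) ⊗ inv b     ≡⟨ cong (_⊗ inv b) (⊗-cancel b (inv-inverse a ua)) ⟩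
      b ⊗ inv b                     ≡⟨ inv-inverse b ub ⟩
      [ 1 ]                         ∎

  quotient-≡1 : ∀ f .{{_ : NonZero f}} → f ∣ N → ∀ x y → IsUnit y →
                toℕ x % f ≡ toℕ y % f → toℕ (x ⊗ inv y) % f ≡ 1 % f
  quotient-≡1 f f∣N x y uy x≡y = begin
    toℕ (x ⊗ inv y) % f               ≡⟨ ≋⇒%-divisor f∣N (≋-⊗ (≋-toℕ x) (≋-toℕ (inv y))) ⟩
    (toℕ x ℕ.* toℕ (inv y)) % f       ≡⟨ ≡.sym (%-absorb 0 (toℕ x) _) ⟩
    (toℕ x % f ℕ.* toℕ (inv y)) % f   ≡⟨ cong (λ r → (r ℕ.* toℕ (inv y)) % f) x≡y ⟩
    (toℕ y % f ℕ.* toℕ (inv y)) % f   ≡⟨ %-absorb 0 (toℕ y) _ ⟩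
    (toℕ y ℕ.* toℕ (inv y)) % f       ≡⟨ ≡.sym (≋⇒%-divisor f∣N (≋-⊗ (≋-toℕ y) (≋-toℕ (inv y)))) ⟩
    toℕ (y ⊗ inv y) % f               ≡⟨ cong (λ r → toℕ r % f) (inv-inverse y uy) ⟩
    toℕ [ 1 ] % f                     ≡⟨ ≋⇒%-divisor f∣N (≋-[] 1) ⟩
    1 % f                             ∎
    where open ≡.≡-Reasoning

module Sums {c ℓ m ℓm : Level} (O : CommutativeRing c ℓ) (V : Module O m ℓm)
            (N : ℕ) .{{_ : NonZero N}} where
  open CommutativeRing O using (1#; _+_)
  open RingNotions O using (fromℕ)
  open Module V
  open Setting O V N
  open Residues N hiding ([_]; _⊕_; _⊗_; IsUnit)
  open Units O V N
  open MonoidSum +ᴹ-commutativeMonoid public using (sum; sum-cong-≋; sum-permute; sum-remove)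
  open CommutativeSemigroupProperties (CommutativeMonoid.commutativeSemigroup +ᴹ-commutativeMonoid) using (interchange)
  open SetoidReasoning ≈ᴹ-setoid

  module _ {a : Level} {A : Set a} where

    ΣV-cong∈ : ∀ (xs : List A) {F G : A → Carrierᴹ} → (∀ x → x ∈ xs → F x ≈ᴹ G x) → ΣV xs F ≈ᴹ ΣV xs G
    ΣV-cong∈ []       F≈G = ≈ᴹ-refl
    ΣV-cong∈ (x ∷ xs) F≈G = +ᴹ-cong (F≈G x (here refl)) (ΣV-cong∈ xs (λ y y∈ → F≈G y (there y∈)))

    ΣV-cong : ∀ (xs : List A) {F G : A → Carrierᴹ} → (∀ x → F x ≈ᴹ G x) → ΣV xs F ≈ᴹ ΣV xs G
    ΣV-cong xs F≈G = ΣV-cong∈ xs (λ x _ → F≈G x)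

    ΣV-zero : ∀ (xs : List A) → ΣV xs (λ _ → 0ᴹ) ≈ᴹ 0ᴹ
    ΣV-zero []       = ≈ᴹ-refl
    ΣV-zero (x ∷ xs) = ≈ᴹ-trans (+ᴹ-identityˡ _) (ΣV-zero xs)

    ΣV-+ : ∀ (xs : List A) (F G : A → Carrierᴹ) → ΣV xs (λ x → F x +ᴹ G x) ≈ᴹ ΣV xs F +ᴹ ΣV xs G
    ΣV-+ []       F G = ≈ᴹ-sym (+ᴹ-identityˡ 0ᴹ)
    ΣV-+ (x ∷ xs) F G = ≈ᴹ-trans (+ᴹ-congˡ (ΣV-+ xs F G)) (interchange _ _ _ _)

    ΣV-*ₗ : ∀ (xs : List A) r (F : A → Carrierᴹ) → r *ₗ ΣV xs F ≈ᴹ ΣV xs (λ x → r *ₗ F x)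
    ΣV-*ₗ []       r F = *ₗ-zeroʳ r
    ΣV-*ₗ (x ∷ xs) r F = ≈ᴹ-trans (*ₗ-distribˡ r (F x) _) (+ᴹ-congˡ (ΣV-*ₗ xs r F))

    ΣV-additive : ∀ (Φ : Carrierᴹ → Carrierᴹ) → (∀ x y → Φ (x +ᴹ y) ≈ᴹ Φ x +ᴹ Φ y) → Φ 0ᴹ ≈ᴹ 0ᴹ →
                  ∀ (xs : List A) F → Φ (ΣV xs F) ≈ᴹ ΣV xs (λ x → Φ (F x))
    ΣV-additive Φ Φ-+ Φ-0 []       F = Φ-0
    ΣV-additive Φ Φ-+ Φ-0 (x ∷ xs) F = ≈ᴹ-trans (Φ-+ _ _) (+ᴹ-congˡ (ΣV-additive Φ Φ-+ Φ-0 xs F))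

    restrict : ∀ {p} {P : Pred A p} → Decidable P → (A → Carrierᴹ) → A → Carrierᴹ
    restrict P? F x with P? x
    ... | yes _ = F x
    ... | no _  = 0ᴹ

    ΣV-filter : ∀ {p} {P : Pred A p} (P? : Decidable P) (xs : List A) F →
                ΣV (filter P? xs) F ≈ᴹ ΣV xs (restrict P? F)
    ΣV-filter P? []       F = ≈ᴹ-refl
    ΣV-filter P? (x ∷ xs) F with P? x
    ... | yes _ = +ᴹ-congˡ (ΣV-filter P? xs F)
    ... | no _  = ≈ᴹ-trans (ΣV-filter P? xs F) (≈ᴹ-sym (+ᴹ-identityˡ _))

  ΣV-swap : ∀ {a b} {A : Set a} {B : Set b} (xs : List A) (ys : List B) (F : A → B → Carrierᴹ) →
            ΣV xs (λ x → ΣV ys (F x)) ≈ᴹ ΣV ys (λ y → ΣV xs (λ x → F x y))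
  ΣV-swap []       ys F = ≈ᴹ-sym (ΣV-zero ys)
  ΣV-swap (x ∷ xs) ys F = begin
    ΣV ys (F x) +ᴹ ΣV xs (λ x → ΣV ys (F x))           ≈⟨ +ᴹ-congˡ (ΣV-swap xs ys F) ⟩
    ΣV ys (F x) +ᴹ ΣV ys (λ y → ΣV xs (λ x → F x y))   ≈⟨ ≈ᴹ-sym (ΣV-+ ys (F x) _) ⟩
    ΣV ys (λ y → F x y +ᴹ ΣV xs (λ x → F x y))         ∎

  ΣV-tabulate : ∀ {a} {A : Set a} n (f : Fin n → A) (F : A → Carrierᴹ) →
                ΣV (tabulate f) F ≈ᴹ sum (λ i → F (f i))
  ΣV-tabulate zero    f F = ≈ᴹ-refl
  ΣV-tabulate (suc n) f F = +ᴹ-congˡ (ΣV-tabulate n (λ i → f (Fin.suc i)) F)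

  ΣV-allFin : ∀ n (F : Fin n → Carrierᴹ) → ΣV (allFin n) F ≈ᴹ sum F
  ΣV-allFin n F = ΣV-tabulate n (λ i → i) F

  ΣV-upTo : ∀ n (F : ℕ → Carrierᴹ) → ΣV (upTo n) F ≈ᴹ sum (λ (i : Fin n) → F (toℕ i))
  ΣV-upTo n F = applyUpTo-sum n (λ k → k)
    where
    applyUpTo-sum : ∀ n (f : ℕ → ℕ) → ΣV (applyUpTo f n) F ≈ᴹ sum (λ (i : Fin n) → F (f (toℕ i)))
    applyUpTo-sum zero    f = ≈ᴹ-refl
    applyUpTo-sum (suc n) f = +ᴹ-congˡ (applyUpTo-sum n (λ k → f (suc k)))

  sum-const : ∀ n x → sum (λ (_ : Fin n) → x) ≈ᴹ fromℕ n *ₗ x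
  sum-const zero    x = ≈ᴹ-sym (*ₗ-zeroˡ x)
  sum-const (suc n) x = begin
    x +ᴹ sum (λ (_ : Fin n) → x)   ≈⟨ +ᴹ-cong (≈ᴹ-sym (*ₗ-identityˡ x)) (sum-const n x) ⟩
    1# *ₗ x +ᴹ fromℕ n *ₗ x        ≈⟨ ≈ᴹ-sym (*ₗ-distribʳ x 1# (fromℕ n)) ⟩
    (1# + fromℕ n) *ₗ x            ∎

  -- Multiplication by a unit w permutes the units, so a sum over the units
  -- may be reindexed along a ↦ a w.
  ΣV-units-reindex : ∀ w → IsUnit w → ∀ F → ΣV units F ≈ᴹ ΣV units (λ a → F (a ⊗ w))
  ΣV-units-reindex w uw F = begin
    ΣV units F                                 ≈⟨ as-sum F ⟩
    sum (restrict unit? F)                     ≈⟨ sum-permute (restrict unit? F) multiplyByW ⟩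
    sum (λ a → restrict unit? F (a ⊗ w))       ≈⟨ sum-cong-≋ restrict-shift ⟩
    sum (restrict unit? (λ a → F (a ⊗ w)))     ≈⟨ ≈ᴹ-sym (as-sum _) ⟩
    ΣV units (λ a → F (a ⊗ w))                 ∎
    where
    unit? : ∀ a → Dec (IsUnit a)
    unit? a = coprime? (toℕ a) N
    as-sum : ∀ G → ΣV units G ≈ᴹ sum (restrict unit? G)
    as-sum G = ≈ᴹ-trans (ΣV-filter unit? (allFin N) G) (ΣV-allFin N (restrict unit? G))
    multiplyByW : Permutation N N
    multiplyByW = permutation (_⊗ w) (_⊗ inv w)
      (λ a → ⊗-cancel a (≡.trans (⊗-comm (inv w) w) (inv-inverse w uw)))
      (λ a → ⊗-cancel a (inv-inverse w uw))
    restrict-shift : ∀ a → restrict unit? F (a ⊗ w) ≈ᴹ restrict unit? (λ a → F (a ⊗ w)) a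
    restrict-shift a with unit? (a ⊗ w) | unit? a
    ... | yes _   | yes _  = ≈ᴹ-refl
    ... | no _    | no _   = ≈ᴹ-refl
    ... | yes uaw | no ¬ua =
      ⊥-elim (¬ua (subst IsUnit (⊗-cancel a (inv-inverse w uw)) (unit-⊗ uaw (inv-unit w uw))))
    ... | no ¬uaw | yes ua = ⊥-elim (¬uaw (unit-⊗ ua uw))

  sum-single-out : ∀ n (R : Fin n → Carrierᴹ) (j₀ : Fin n) x y →
                   R j₀ ≈ᴹ x → (∀ j → j ≢ j₀ → R j ≈ᴹ y) → sum R ≈ᴹ x +ᴹ fromℕ (n ∸ 1) *ₗ y
  sum-single-out zero    R ()
  sum-single-out (suc n) R j₀ x y Rj₀≈x R≈y = begin
    sum R                                   ≈⟨ sum-remove {i = j₀} R ⟩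
    R j₀ +ᴹ sum (removeAt R j₀)
      ≈⟨ +ᴹ-cong Rj₀≈x (sum-cong-≋ (λ i → R≈y (Fin.punchIn j₀ i) (punchInᵢ≢i j₀ i))) ⟩
    x +ᴹ sum (λ (_ : Fin n) → y)            ≈⟨ +ᴹ-congˡ (sum-const n y) ⟩
    x +ᴹ fromℕ n *ₗ y                       ∎

module Characters {c ℓ m ℓm : Level} (O : CommutativeRing c ℓ) (V : Module O m ℓm)
                  (N : ℕ) .{{_ : NonZero N}} (X : Setting.Character O V N) where
  open CommutativeRing O
  open Setting O V N
  open Residues N hiding ([_]; _⊕_; _⊗_; IsUnit)
  open Units O V N
  open Character X
  open SetoidReasoning setoid

  χ⁻¹ : ZN → Carrier
  χ⁻¹ = inverseChar χ

  χ⁻¹-χ : ∀ a → IsUnit a → χ⁻¹ a * χ a ≈ 1#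
  χ⁻¹-χ a ua = begin
    χ (inv a) * χ a    ≈⟨ sym (mult (inv a) a (inv-unit a ua) ua) ⟩
    χ (inv a ⊗ a)      ≈⟨ reflexive (cong χ (≡.trans (⊗-comm (inv a) a) (inv-inverse a ua))) ⟩
    χ [ 1 ]            ≈⟨ one ⟩
    1#                 ∎

  χ⁻¹-mult : ∀ a b → IsUnit a → IsUnit b → χ⁻¹ (a ⊗ b) ≈ χ⁻¹ a * χ⁻¹ b
  χ⁻¹-mult a b ua ub = begin
    χ (inv (a ⊗ b))      ≈⟨ reflexive (cong χ (inv-⊗ a b ua ub)) ⟩
    χ (inv a ⊗ inv b)    ≈⟨ mult (inv a) (inv b) (inv-unit a ua) (inv-unit b ub) ⟩
    χ⁻¹ a * χ⁻¹ b        ∎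

  -- When χ factors through (Z/fZ)^×, χ⁻¹ only depends on residues mod f;
  -- in particular it computes the primitive character attached to χ⁻¹.
  module ModConductor (f : ℕ) .{{_ : NonZero f}} (f∣N : f ∣ N) (factors : FactorsThrough χ f) where

    χ⁻¹-trivial : ∀ z → IsUnit z → toℕ z % f ≡ 1 % f → χ⁻¹ z ≈ 1#
    χ⁻¹-trivial z uz z≡1 = begin
      χ⁻¹ z              ≈⟨ sym (*-identityʳ _) ⟩
      χ⁻¹ z * 1#         ≈⟨ *-congˡ (sym (factors z uz (%≡⇒∣∣-∣ (toℕ z) 1 z≡1))) ⟩
      χ⁻¹ z * χ z        ≈⟨ χ⁻¹-χ z uz ⟩
      1#                 ∎

    χ⁻¹-cong : ∀ x y → IsUnit x → IsUnit y → toℕ x % f ≡ toℕ y % f → χ⁻¹ x ≈ χ⁻¹ y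
    χ⁻¹-cong x y ux uy x≡y = begin
      χ⁻¹ x                ≈⟨ reflexive (cong χ⁻¹ (≡.sym (⊗-cancel x y⁻¹y≡1))) ⟩
      χ⁻¹ (z ⊗ y)          ≈⟨ χ⁻¹-mult z y uz uy ⟩
      χ⁻¹ z * χ⁻¹ y        ≈⟨ *-congʳ (χ⁻¹-trivial z uz (quotient-≡1 f f∣N x y uy x≡y)) ⟩
      1# * χ⁻¹ y           ≈⟨ *-identityˡ _ ⟩
      χ⁻¹ y                ∎
      where
      z : ZN
      z = x ⊗ inv y
      uz : IsUnit z
      uz = unit-⊗ ux (inv-unit y uy)
      y⁻¹y≡1 : inv y ⊗ y ≡ [ 1 ]
      y⁻¹y≡1 = ≡.trans (⊗-comm (inv y) y) (inv-inverse y uy)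

    primitiveValue-≈ : ∀ n → Coprime n f → ∀ x → IsUnit x → toℕ x % f ≡ n % f →
                       primitiveValue χ⁻¹ f n ≈ χ⁻¹ x
    primitiveValue-≈ n n⊥f x ux x≡n with coprime? n f
    ... | no ¬n⊥f = ⊥-elim (¬n⊥f n⊥f)
    ... | yes _ with filter (λ a → f ∣? ∣ toℕ a - n ∣) units in candidates
    ...   | a ∷ _ = χ⁻¹-cong a x (∈units⇒unit (proj₁ a∈)) ux
                      (≡.trans (∣∣-∣⇒%≡ (toℕ a) n (proj₂ a∈)) (≡.sym x≡n))
      where
      a∈ : a ∈ units × f ∣ ∣ toℕ a - n ∣
      a∈ = ∈-filter⁻ (λ a → f ∣? ∣ toℕ a - n ∣) {xs = units} (subst (a ∈_) (≡.sym candidates) (here ≡.refl))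
    ...   | [] = absurd (subst (x ∈_) candidates
                   (∈-filter⁺ (λ a → f ∣? ∣ toℕ a - n ∣) (unit⇒∈units ux) (%≡⇒∣∣-∣ (toℕ x) n x≡n)))
      where
      absurd : {B : Set ℓ} → x ∈ [] → B
      absurd ()

module HeckeComputation
  {c ℓ m ℓm : Level} (O : CommutativeRing c ℓ) (V : Module O m ℓm) (N : ℕ) .{{_ : NonZero N}}
  {kind : Kind} (S : Setting.SymbolSpace O V N kind)
  (l : ℕ) (l-prime : Prime l) (l∣N : l ∣ N)
  (U : Module.Carrierᴹ V → Module.Carrierᴹ V) (U-op : Setting.OnSymbols.IsUOperator O V N S l U)
  (X : Setting.Character O V N) (ψ⁻¹ : Fin N → CommutativeRing.Carrier O)
  (g h : ℕ) (g∣N : g ∣ N) (g⊥h : Coprime g h) (l∤g : ¬ (l ∣ g)) (l∤h : ¬ (l ∣ h))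
  (f : ℕ) (conductor : Setting.IsConductor O V N (Setting.Character.χ X) f)
  where
  open CommutativeRing O using (Carrier; _*_; _≈_; 1#; *-comm; *-assoc; *-congʳ; *-congˡ; *-identityʳ)
    renaming (trans to ≈-trans)
  open RingNotions O using (fromℕ)
  open Module V
  open Setting O V N
  open SymbolSpace S
  open OnSymbols S
  open IsUOperator U-op
  open Residues N hiding ([_]; _⊕_; _⊗_; IsUnit)
  open LevelArithmetic N
  open Units O V N
  open Sums O V N
  open Characters O V N X
  open ModuleIdentities O V
  open SetoidReasoning ≈ᴹ-setoid

  instance
    _ : NonZero l
    _ = prime⇒nonZero l-prime
    _ : NonZero f
    _ = ∣-nonZero (IsConductor.divides conductor)

  open ModConductor f (IsConductor.divides conductor) (IsConductor.factors conductor)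

  -- α^{G,h}_{χ,ψ} without its normalising factor: α e G h χ⁻¹ ψ⁻¹ = e T(G)
  T : ℕ → Carrierᴹ
  T G = ΣV units (λ a → ΣV units (λ b → (χ⁻¹ a * ψ⁻¹ b) *ₗ symb ([ G ] ⊗ a) ([ h ] ⊗ b)))

  T-twisted : ℕ → ZN → Carrierᴹ
  T-twisted G w = ΣV units (λ a → ΣV units (λ b → (χ⁻¹ a * ψ⁻¹ b) *ₗ symb ([ G ] ⊗ (a ⊗ w)) ([ h ] ⊗ b)))

  twist-trivial : ∀ G w → IsUnit w → χ⁻¹ w ≈ 1# → T-twisted G w ≈ᴹ T G
  twist-trivial G w uw χ⁻¹w≈1 = ≈ᴹ-sym (≈ᴹ-trans (ΣV-units-reindex w uw Φ) (ΣV-cong∈ units untwist))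
    where
    Φ : ZN → Carrierᴹ
    Φ a = ΣV units (λ b → (χ⁻¹ a * ψ⁻¹ b) *ₗ symb ([ G ] ⊗ a) ([ h ] ⊗ b))
    untwist : ∀ a → a ∈ units →
              Φ (a ⊗ w) ≈ᴹ ΣV units (λ b → (χ⁻¹ a * ψ⁻¹ b) *ₗ symb ([ G ] ⊗ (a ⊗ w)) ([ h ] ⊗ b))
    untwist a a∈ = ΣV-cong units (λ b → *ₗ-congʳ (*-congʳ χ⁻¹aw≈χ⁻¹a))
      where
      χ⁻¹aw≈χ⁻¹a : χ⁻¹ (a ⊗ w) ≈ χ⁻¹ a
      χ⁻¹aw≈χ⁻¹a = ≈-trans (χ⁻¹-mult a w (∈units⇒unit a∈) uw) (≈-trans (*-congˡ χ⁻¹w≈1) (*-identityʳ _))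

  twist-collapse : ∀ G G′ k w → IsUnit k → (∀ a → [ G ] ⊗ ((a ⊗ k) ⊗ w) ≡ [ G′ ] ⊗ a) →
                   T-twisted G w ≈ᴹ χ⁻¹ k *ₗ T G′
  twist-collapse G G′ k w uk G-to-G′ =
    ≈ᴹ-trans (ΣV-units-reindex k uk F) (≈ᴹ-trans (ΣV-cong∈ units collapse) (≈ᴹ-sym (ΣV-*ₗ units (χ⁻¹ k) Φ)))
    where
    F Φ : ZN → Carrierᴹ
    F a = ΣV units (λ b → (χ⁻¹ a * ψ⁻¹ b) *ₗ symb ([ G ] ⊗ (a ⊗ w)) ([ h ] ⊗ b))
    Φ a = ΣV units (λ b → (χ⁻¹ a * ψ⁻¹ b) *ₗ symb ([ G′ ] ⊗ a) ([ h ] ⊗ b))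
    collapse : ∀ a → a ∈ units → F (a ⊗ k) ≈ᴹ χ⁻¹ k *ₗ Φ a
    collapse a a∈ = ≈ᴹ-trans (ΣV-cong units term) (≈ᴹ-sym (ΣV-*ₗ units (χ⁻¹ k) _))
      where
      coefficient : ∀ b → χ⁻¹ (a ⊗ k) * ψ⁻¹ b ≈ χ⁻¹ k * (χ⁻¹ a * ψ⁻¹ b)
      coefficient b =
        ≈-trans (*-congʳ (≈-trans (χ⁻¹-mult a k (∈units⇒unit a∈) uk) (*-comm _ _))) (*-assoc _ _ _)
      term : ∀ b → (χ⁻¹ (a ⊗ k) * ψ⁻¹ b) *ₗ symb ([ G ] ⊗ ((a ⊗ k) ⊗ w)) ([ h ] ⊗ b)
                 ≈ᴹ χ⁻¹ k *ₗ ((χ⁻¹ a * ψ⁻¹ b) *ₗ symb ([ G′ ] ⊗ a) ([ h ] ⊗ b))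
      term b = ≈ᴹ-trans (*ₗ-cong (coefficient b) (≈ᴹ-reflexive (cong (λ u → symb u ([ h ] ⊗ b)) (G-to-G′ a))))
                        (*ₗ-assoc _ _ _)

  W : ℕ → Fin l → ZN
  W m j = [ 1 ℕ.+ toℕ j ℕ.* m ]

  -- For N = lᵗ m with f ∣ m, a twist by 1 + j m prime to l is trivial:
  -- it is a unit congruent to 1 modulo the conductor.
  twist-W-trivial : ∀ G t m → N ≡ l ^ t ℕ.* m → f ∣ m → ∀ j → Coprime (1 ℕ.+ toℕ j ℕ.* m) l →
                    T-twisted G (W m j) ≈ᴹ T G
  twist-W-trivial G t m N≡lᵗm f∣m j W⊥l = twist-trivial G (W m j) W-unit (χ⁻¹-trivial (W m j) W-unit W≡1)
    where
    W-unit : IsUnit (W m j)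
    W-unit = unit-[] t N≡lᵗm W⊥l (coprime-1+* (toℕ j) m)
    W≡1 : toℕ (W m j) % f ≡ 1 % f
    W≡1 = ≡.trans (≋⇒%-divisor (IsConductor.divides conductor) (≋-[] _))
                  (%-remove-+ʳ 1 (∣n⇒∣m*n (toℕ j) f∣m))

  U-ΣV : ∀ {a} {A : Set a} (xs : List A) F → U (ΣV xs F) ≈ᴹ ΣV xs (λ x → U (F x))
  U-ΣV = ΣV-additive U U-+ U-zero
    where
    U-zero : U 0ᴹ ≈ᴹ 0ᴹ
    U-zero = ≈ᴹ-trans (U-cong _ _ (≈ᴹ-sym (*ₗ-zeroˡ 0ᴹ))) (≈ᴹ-trans (U-* _ _) (*ₗ-zeroˡ _))

  module Expansion (t′ m : ℕ) (N≡lᵗm : N ≡ l ^ suc t′ ℕ.* m)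
                   (nondegenerate : kind ≡ cuspidalAtZero → l ^ suc t′ ℕ.* g ≢ N) where
    G G′ : ℕ
    G  = l ^ suc t′ ℕ.* g
    G′ = l ^ t′ ℕ.* g

    N≡l[N/l] : N ≡ l ℕ.* (N /ₑ l)
    N≡l[N/l] = *-/ₑ l l∣N

    N/l≡lᵗ′m : N /ₑ l ≡ l ^ t′ ℕ.* m
    N/l≡lᵗ′m = NatProps.*-cancelˡ-≡ _ _ l
      (≡.trans (≡.sym N≡l[N/l]) (≡.trans N≡lᵗm (NatProps.*-assoc l (l ^ t′) m)))

    G⊥h : Coprime G h
    G⊥h = Coprime.sym (coprime-*ʳ (coprime-^ʳ (suc t′) (prime∤⇒coprime l-prime l∤h)) (Coprime.sym g⊥h))

    G∣N : G ∣ N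
    G∣N = coprime⇒*∣ (Coprime.sym (coprime-^ʳ (suc t′) (prime∤⇒coprime l-prime l∤g)))
                     (divides m (≡.trans N≡lᵗm (NatProps.*-comm _ m))) g∣N

    -- the hypotheses of the defining property of U_l on [G a : h b]
    unimodular : ∀ a b → IsUnit a → IsUnit b → Unimodular ([ l ] ⊗ ([ G′ ] ⊗ a)) ([ h ] ⊗ b)
    unimodular a b ua ub = subst (λ u → Unimodular u ([ h ] ⊗ b)) (split-factor l (l ^ t′) g a)
                                 (unimodular-pair G h a b ua ub G⊥h)

    nonzero : ∀ a → IsUnit a → kind ≡ cuspidalAtZero → [ l ] ⊗ ([ G′ ] ⊗ a) ≢ [ 0 ]
    nonzero a ua cusp Ga≡0 = nondegenerate cusp
      (∣-antisym G∣N (zero-product G a ua (≡.trans (split-factor l (l ^ t′) g a) Ga≡0)))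

    -- U_l on a single symbol: the l translates of [lᵗ⁻¹ g a : h b] by
    -- multiples of N/l, reindexed by j ↦ a g j mod l, are the twists by 1 + j m.
    U-symbol : ∀ a b → IsUnit a → IsUnit b →
      U (symb ([ G ] ⊗ a) ([ h ] ⊗ b)) ≈ᴹ ΣV (allFin l) (λ j → symb ([ G′ ] ⊗ (a ⊗ W m j)) ([ h ] ⊗ b))
    U-symbol a b ua ub = begin
      U (symb ([ G ] ⊗ a) ([ h ] ⊗ b))
        ≈⟨ ≈ᴹ-reflexive (cong (λ v → U (symb v ([ h ] ⊗ b))) (split-factor l (l ^ t′) g a)) ⟩
      U (symb ([ l ] ⊗ u) ([ h ] ⊗ b))
        ≈⟨ U-symb u ([ h ] ⊗ b) (unimodular a b ua ub) (nonzero a ua) ⟩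
      ΣV (upTo l) F
        ≈⟨ ΣV-upTo l F ⟩
      sum (λ (k : Fin l) → F (toℕ k))
        ≈⟨ sum-reindex-* +ᴹ-commutativeMonoid l (toℕ a ℕ.* g) ag⊥l F ⟩
      sum (λ (j : Fin l) → F ((toℕ a ℕ.* g ℕ.* toℕ j) % l))
        ≈⟨ sum-cong-≋ {l} (λ j → ≈ᴹ-reflexive (cong (λ v → symb v ([ h ] ⊗ b))
             (shift-as-product l (N /ₑ l) (l ^ t′) m g a (toℕ j) N≡l[N/l] N/l≡lᵗ′m))) ⟩
      sum (λ (j : Fin l) → symb ([ G′ ] ⊗ (a ⊗ W m j)) ([ h ] ⊗ b))
        ≈⟨ ≈ᴹ-sym (ΣV-allFin l _) ⟩
      ΣV (allFin l) (λ j → symb ([ G′ ] ⊗ (a ⊗ W m j)) ([ h ] ⊗ b))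
        ∎
      where
      u : ZN
      u = [ G′ ] ⊗ a
      F : ℕ → Carrierᴹ
      F k = symb (u ⊕ [ k ℕ.* (N /ₑ l) ]) ([ h ] ⊗ b)
      ag⊥l : Coprime (toℕ a ℕ.* g) l
      ag⊥l = coprime-*ˡ (prime∤⇒coprime l-prime (coprime⇒∤ l-prime l∣N ua)) (prime∤⇒coprime l-prime l∤g)

    U-T : U (T G) ≈ᴹ sum (λ j → T-twisted G′ (W m j))
    U-T = begin
      U (T G)
        ≈⟨ U-ΣV units _ ⟩
      ΣV units (λ a → U (ΣV units (λ b → w a b *ₗ symb ([ G ] ⊗ a) (y b))))
        ≈⟨ ΣV-cong units (λ a → U-ΣV units _) ⟩
      ΣV units (λ a → ΣV units (λ b → U (w a b *ₗ symb ([ G ] ⊗ a) (y b))))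
        ≈⟨ ΣV-cong∈ units (λ a a∈ → ΣV-cong∈ units (λ b b∈ →
             U-on-term a b (∈units⇒unit a∈) (∈units⇒unit b∈))) ⟩
      ΣV units (λ a → ΣV units (λ b → ΣV (allFin l) (λ j → w a b *ₗ Z a b j)))
        ≈⟨ ΣV-cong units (λ a → ΣV-swap units (allFin l) _) ⟩
      ΣV units (λ a → ΣV (allFin l) (λ j → ΣV units (λ b → w a b *ₗ Z a b j)))
        ≈⟨ ΣV-swap units (allFin l) _ ⟩
      ΣV (allFin l) (λ j → T-twisted G′ (W m j))
        ≈⟨ ΣV-allFin l _ ⟩
      sum (λ j → T-twisted G′ (W m j))
        ∎
      where
      y : ZN → ZN
      y b = [ h ] ⊗ b
      w : ZN → ZN → Carrier
      w a b = χ⁻¹ a * ψ⁻¹ b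
      Z : ZN → ZN → Fin l → Carrierᴹ
      Z a b j = symb ([ G′ ] ⊗ (a ⊗ W m j)) (y b)
      U-on-term : ∀ a b → IsUnit a → IsUnit b →
                  U (w a b *ₗ symb ([ G ] ⊗ a) (y b)) ≈ᴹ ΣV (allFin l) (λ j → w a b *ₗ Z a b j)
      U-on-term a b ua ub =
        ≈ᴹ-trans (U-* _ _) (≈ᴹ-trans (*ₗ-congˡ (U-symbol a b ua ub)) (ΣV-*ₗ (allFin l) (w a b) (Z a b)))

  -- Case t < s, i.e. l ∣ m: every 1 + j m is prime to l, so all l twists
  -- are trivial.
  U-T-below : ∀ t′ m → N ≡ l ^ suc t′ ℕ.* m → f ∣ m → l ∣ m →
              U (T (l ^ suc t′ ℕ.* g)) ≈ᴹ fromℕ l *ₗ T (l ^ t′ ℕ.* g)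
  U-T-below t′ m N≡lᵗm f∣m l∣m = begin
    U (T G)
      ≈⟨ U-T ⟩
    sum (λ j → T-twisted G′ (W m j))
      ≈⟨ sum-cong-≋ {l} (λ j → twist-W-trivial G′ (suc t′) m N≡lᵗm f∣m j
                                  (coprime-∣ʳ (coprime-1+* (toℕ j) m) l∣m)) ⟩
    sum (λ (_ : Fin l) → T G′)
      ≈⟨ sum-const l (T G′) ⟩
    fromℕ l *ₗ T G′
      ∎
    where
    -- lᵗ g = N = lᵗ m would force g = m, which is divisible by l
    nondegenerate : kind ≡ cuspidalAtZero → l ^ suc t′ ℕ.* g ≢ N
    nondegenerate _ lᵗg≡N = l∤g (subst (l ∣_) (≡.sym g≡m) l∣m)
      where
      instance
        _ : NonZero (l ^ suc t′)
        _ = NatProps.m^n≢0 l (suc t′)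
      g≡m : g ≡ m
      g≡m = NatProps.*-cancelˡ-≡ g m (l ^ suc t′) (≡.trans lᵗg≡N N≡lᵗm)
    open Expansion t′ m N≡lᵗm nondegenerate

  -- Case t = s, i.e. l ∤ m: exactly one 1 + j₀ m is divisible by l, and
  -- its twist gives χ⁻¹(l) T(lᵗ g); the other l - 1 twists are trivial.
  U-T-top : ∀ t′ m → N ≡ l ^ suc t′ ℕ.* m → f ∣ m → ¬ (l ∣ m) →
            (kind ≡ cuspidalAtZero → l ^ suc t′ ℕ.* g ≢ N) →
            U (T (l ^ suc t′ ℕ.* g))
              ≈ᴹ primitiveValue χ⁻¹ f l *ₗ T (l ^ suc t′ ℕ.* g) +ᴹ fromℕ (l ∸ 1) *ₗ T (l ^ t′ ℕ.* g)
  U-T-top t′ m N≡lᵗm f∣m l∤m nondegenerate = begin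
    U (T G)
      ≈⟨ U-T ⟩
    sum (λ j → T-twisted G′ (W m j))
      ≈⟨ sum-single-out l _ j₀ _ _ degenerate-twist
           (λ j j≢j₀ → twist-W-trivial G′ (suc t′) m N≡lᵗm f∣m j (others j j≢j₀)) ⟩
    primitiveValue χ⁻¹ f l *ₗ T G +ᴹ fromℕ (l ∸ 1) *ₗ T G′
      ∎
    where
    open Expansion t′ m N≡lᵗm nondegenerate
    j₀ : Fin l
    j₀ = proj₁ (distinguished-residue l-prime l∤m)
    l∣W₀ : l ∣ 1 ℕ.+ toℕ j₀ ℕ.* m
    l∣W₀ = proj₁ (proj₂ (distinguished-residue l-prime l∤m))
    others : ∀ j → j ≢ j₀ → Coprime (1 ℕ.+ toℕ j ℕ.* m) l
    others = proj₂ (proj₂ (distinguished-residue l-prime l∤m))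
    l⊥m : Coprime l m
    l⊥m = Coprime.sym (prime∤⇒coprime l-prime l∤m)
    -- the unit k = l + m, congruent to l modulo f
    k : ZN
    k = [ l ℕ.+ m ]
    k-unit : IsUnit k
    k-unit = unit-[] (suc t′) N≡lᵗm
      (prime∤⇒coprime l-prime (λ l∣l+m → l∤m (∣m+n∣m⇒∣n l∣l+m ∣-refl)))
      (subst (λ x → Coprime x m) (NatProps.+-comm m l) (Coprime.coprime-+ l⊥m))
    χ⁻¹k≈χ⁻¹[l] : primitiveValue χ⁻¹ f l ≈ χ⁻¹ k
    χ⁻¹k≈χ⁻¹[l] = primitiveValue-≈ l (coprime-∣ʳ l⊥m f∣m) k k-unit
      (≡.trans (≋⇒%-divisor (IsConductor.divides conductor) (≋-[] _)) (%-remove-+ʳ l f∣m))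
    degenerate-twist : T-twisted G′ (W m j₀) ≈ᴹ primitiveValue χ⁻¹ f l *ₗ T G
    degenerate-twist =
      ≈ᴹ-trans (twist-collapse G′ G k (W m j₀) k-unit
                  (λ a → degenerate-product l (l ^ t′) m g a (toℕ j₀) (_∣_.quotient l∣W₀)
                           N≡lᵗm (≡.trans (_∣_.equality l∣W₀) (NatProps.*-comm _ l))))
               (*ₗ-congʳ (CommutativeRing.sym O χ⁻¹k≈χ⁻¹[l]))

  U-α-below : ∀ e t′ m → N ≡ l ^ suc t′ ℕ.* m → f ∣ m → l ∣ m →
              U (α e (l ^ suc t′ ℕ.* g) h χ⁻¹ ψ⁻¹) ≈ᴹ fromℕ l *ₗ α e (l ^ t′ ℕ.* g) h χ⁻¹ ψ⁻¹
  U-α-below e t′ m N≡lᵗm f∣m l∣m = begin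
    U (e *ₗ T (l ^ suc t′ ℕ.* g))         ≈⟨ U-* e _ ⟩
    e *ₗ U (T (l ^ suc t′ ℕ.* g))         ≈⟨ *ₗ-congˡ (U-T-below t′ m N≡lᵗm f∣m l∣m) ⟩
    e *ₗ (fromℕ l *ₗ T (l ^ t′ ℕ.* g))    ≈⟨ *ₗ-comm e _ _ ⟩
    fromℕ l *ₗ (e *ₗ T (l ^ t′ ℕ.* g))    ∎

  U-α-top : ∀ e t′ m → N ≡ l ^ suc t′ ℕ.* m → f ∣ m → ¬ (l ∣ m) →
            (kind ≡ cuspidalAtZero → l ^ suc t′ ℕ.* g ≢ N) →
            U (α e (l ^ suc t′ ℕ.* g) h χ⁻¹ ψ⁻¹)
              +ᴹ -ᴹ (primitiveValue χ⁻¹ f l *ₗ α e (l ^ suc t′ ℕ.* g) h χ⁻¹ ψ⁻¹)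
              ≈ᴹ fromℕ (l ∸ 1) *ₗ α e (l ^ t′ ℕ.* g) h χ⁻¹ ψ⁻¹
  U-α-top e t′ m N≡lᵗm f∣m l∤m nondegenerate = begin
    U (e *ₗ T G) +ᴹ -ᴹ (pv *ₗ (e *ₗ T G))
      ≈⟨ +ᴹ-congʳ (U-* e _) ⟩
    e *ₗ U (T G) +ᴹ -ᴹ (pv *ₗ (e *ₗ T G))
      ≈⟨ +ᴹ-congʳ (*ₗ-congˡ (U-T-top t′ m N≡lᵗm f∣m l∤m nondegenerate)) ⟩
    e *ₗ (pv *ₗ T G +ᴹ fromℕ (l ∸ 1) *ₗ T G′) +ᴹ -ᴹ (pv *ₗ (e *ₗ T G))
      ≈⟨ *ₗ-cancel-term e pv _ _ ⟩
    e *ₗ (fromℕ (l ∸ 1) *ₗ T G′)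
      ≈⟨ *ₗ-comm e _ _ ⟩
    fromℕ (l ∸ 1) *ₗ (e *ₗ T G′)
      ∎
    where
    G G′ : ℕ
    G  = l ^ suc t′ ℕ.* g
    G′ = l ^ t′ ℕ.* g
    pv : Carrier
    pv = primitiveValue χ⁻¹ f l

proposition2p20 :
  {c ℓr m ℓm : Level} (O : CommutativeRing c ℓr) (V : Module O m ℓm) →
  let open CommutativeRing O
      open Module V
      open RingNotions O
  in
  -- standing assumptions: p odd prime, M ≥ 1, p ∤ M φ(M), N = M p
  (p M N : ℕ) → Prime p → p ≢ 2 → 1 ≤ M →
  ¬ (p ∣ M ℕ.* totient M) → .{{_ : NonZero N}} → N ≡ M ℕ.* p →
  -- O plays the role of Z_p[μ_φ(N)]
  IsZpCyclotomicLike p →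
  let open Setting O V N in
  -- H ⊗ O: modular symbols of level N, or cuspidal at zero
  (kind : Kind) (S : SymbolSpace kind) →
  let open OnSymbols S in
  -- l prime, l ∣ N, s = v_l(N)
  (l : ℕ) → Prime l → l ∣ N →
  (s : ℕ) → l ^ s ∣ N → ¬ (l ^ ℕ.suc s ∣ N) →
  -- U_l-operator on H (extended O-linearly)
  (U : Carrierᴹ → Carrierᴹ) → IsUOperator l U →
  -- g, h relatively prime positive divisors of N, not divisible by l
  (g h : ℕ) → 1 ≤ g → 1 ≤ h → g ∣ N → h ∣ N → Coprime g h →
  ¬ (l ∣ g) → ¬ (l ∣ h) →
  -- χ ∈ X_N, θ a character of Δ = (Z/N)^×/⟨-1⟩, ψ = θ χ⁻¹
  (χ θ : Character) → Character.χ θ (⊖ [ 1 ]) ≈ 1# →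
  let χinv : ZN → Carrier
      χinv = inverseChar (Character.χ χ)
      ψ : ZN → Carrier
      ψ a = Character.χ θ a * χinv a
      ψinv : ZN → Carrier
      ψinv = inverseChar ψ
  in
  -- f = f_χ is the conductor of χ
  (f : ℕ) → IsConductor (Character.χ χ) f →
  (t : ℕ) → 1 ≤ t → t ≤ s → f ∣ (N /ₑ (l ^ t)) →
  -- e = 1 / φ(N)²
  (e : Carrier) → e * fromℕ (totient N ℕ.* totient N) ≈ 1# →
  (t < s →
     U (α e (l ^ t ℕ.* g) h χinv ψinv)
       ≈ᴹ fromℕ l *ₗ α e (l ^ (t ∸ 1) ℕ.* g) h χinv ψinv)
  ×
  (t ≡ s → (kind ≡ cuspidalAtZero → l ^ s ℕ.* g ≢ N) →
     U (α e (l ^ s ℕ.* g) h χinv ψinv)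
       +ᴹ -ᴹ (primitiveValue χinv f l *ₗ α e (l ^ s ℕ.* g) h χinv ψinv)
       ≈ᴹ fromℕ (l ∸ 1) *ₗ α e (l ^ (s ∸ 1) ℕ.* g) h χinv ψinv)
-- The case t = 0 is excluded
-- by 1 ≤ t.
proposition2p20 O V _ _ N _ _ _ _ ⦃ _ ⦄ _ _ kind S l l-prime l∣N s lˢ∣N lˢ⁺¹∤N U U-op
                g h _ _ g∣N _ g⊥h l∤g l∤h X _ _ f conductor zero () _ _ _ _
proposition2p20 O V _ _ N _ _ _ _ ⦃ _ ⦄ _ _ kind S l l-prime l∣N s lˢ∣N lˢ⁺¹∤N U U-op
                g h _ _ g∣N _ g⊥h l∤g l∤h X _ _ f conductor (suc t′) _ t≤s f∣m e _ =
  (λ t<s → U-α-below e t′ m N≡lᵗm f∣m (l∣m t<s)) ,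
  (λ { refl nondegenerate → U-α-top e t′ m N≡lᵗm f∣m (l∤m refl) nondegenerate })
  where
  open HeckeComputation O V N S l l-prime l∣N U U-op X _ g h g∣N g⊥h l∤g l∤h f conductor
  instance
    _ : NonZero (l ^ suc t′)
    _ = NatProps.m^n≢0 l (suc t′) ⦃ prime⇒nonZero l-prime ⦄
  m : ℕ
  m = N /ₑ (l ^ suc t′)
  N≡lᵗm : N ≡ l ^ suc t′ ℕ.* m
  N≡lᵗm = *-/ₑ (l ^ suc t′) (∣-trans (^-∣ l t≤s) lˢ∣N)
  l∣m : suc t′ < s → l ∣ m
  l∣m t<s = *-cancelˡ-∣ (l ^ suc t′)
    (≡.subst₂ _∣_ (NatProps.*-comm l (l ^ suc t′)) N≡lᵗm (∣-trans (^-∣ l t<s) lˢ∣N))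
  l∤m : suc t′ ≡ s → ¬ (l ∣ m)
  l∤m t≡s l∣m = lˢ⁺¹∤N (≡.subst (λ k → l ^ suc k ∣ N) t≡s
    (≡.subst₂ _∣_ (NatProps.*-comm (l ^ suc t′) l) (≡.sym N≡lᵗm) (*-monoʳ-∣ (l ^ suc t′) l∣m)))
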